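{- There does not exist a strongly co-edge-regular graph with parameters $(n,k,2,\ell)$ which contains an induced quadrangle (induced $4$-cycle) and satisfies $\frac{3k}{4}\leqslant\ell\leqslant k-3$.
   Context: All graphs are finite, undirected and simple. A co-edge-regular graph with parameters $(n,k,c)$ is a $k$-regular graph on $n$ vertices, neither complete nor edgeless, in which any two distinct non-adjacent vertices have exactly $c$ common neighbours. For adjacent $x,y$, $a_{xy}$ is the number of common neighbours of $x,y$. A strongly co-edge-regular graph with parameters $(n,k,c,\ell)$ is a co-edge-regular graph with parameters $(n,k,c)$ such that for any two distinct non-adjacent vertices $x,z$, $\sum_{y\sim x,\,y\sim z}a_{xy}=\ell$. -}

module Defs where

open import Data.Nat using (ℕ; zero; suc; _+_; _*_; _≤_)
open import Data.Fin using (Fin)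
open import Data.Bool using (Bool; true; false; _∧_; not)
open import Data.Product using (Σ; _×_; ∃-syntax)
open import Relation.Binary.PropositionalEquality using (_≡_; _≢_)
open import Relation.Nullary using (¬_)

sumFin : (n : ℕ) → (Fin n → ℕ) → ℕ
sumFin zero    f = 0
sumFin (suc n) f = f Fin.zero + sumFin n (λ i → f (Fin.suc i))

countFin : (n : ℕ) → (Fin n → Bool) → ℕ
countFin n p = sumFin n (λ i → boolToℕ (p i))
  where
  boolToℕ : Bool → ℕ
  boolToℕ true  = 1
  boolToℕ false = 0

record Graph (n : ℕ) : Set where
  field
    adj     : Fin n → Fin n → Bool
    symm    : ∀ x y → adj x y ≡ adj y x
    irrefl  : ∀ x → adj x x ≡ false

module _ {n : ℕ} (G : Graph n) where
  open Graph G

  _∼_ : Fin n → Fin n → Set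
  x ∼ y = adj x y ≡ true

  degree : Fin n → ℕ
  degree x = countFin n (adj x)

  common : Fin n → Fin n → ℕ
  common x y = countFin n (λ z → adj x z ∧ adj z y)

  IsRegular : ℕ → Set
  IsRegular k = ∀ x → degree x ≡ k

  IsComplete : Set
  IsComplete = ∀ x y → x ≢ y → x ∼ y

  IsEdgeless : Set
  IsEdgeless = ∀ x y → ¬ (x ∼ y)

  IsCoEdgeRegular : ℕ → ℕ → Set
  IsCoEdgeRegular k c =
    IsRegular k × ¬ IsComplete × ¬ IsEdgeless ×
    (∀ x y → x ≢ y → ¬ (x ∼ y) → common x y ≡ c)

  ellSum : Fin n → Fin n → ℕ
  ellSum x z = sumFin n (λ y → weight (adj y x ∧ adj y z) (common x y))
    where
    weight : Bool → ℕ → ℕ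
    weight true  m = m
    weight false _ = 0

  IsStronglyCoEdgeRegular : ℕ → ℕ → ℕ → Set
  IsStronglyCoEdgeRegular k c ℓ =
    IsCoEdgeRegular k c ×
    (∀ x z → x ≢ z → ¬ (x ∼ z) → ellSum x z ≡ ℓ)

  HasInducedQuadrangle : Set
  HasInducedQuadrangle =
    ∃[ a ] ∃[ b ] ∃[ c ] ∃[ d ]
      (a ≢ b × a ≢ c × a ≢ d × b ≢ c × b ≢ d × c ≢ d ×
       a ∼ b × b ∼ c × c ∼ d × d ∼ a ×
       ¬ (a ∼ c) × ¬ (b ∼ d))

-- Let a b c d be an induced quadrangle.  As c = 2, b and d are the only common neighbours
-- of a and c, so ℓ = a_ab + a_ad, and ℓ + 3 ≤ k leaves a neighbour u of a adjacent to
-- neither b nor d.  Counting N(a) around such a free u gives a_au + ℓ < k, hence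
-- 3 (a_au + 1) ≤ ℓ by 3k ≤ 4ℓ.  In a k-regular graph the exteriors N(v) ∖ N[a] and
-- N(a) ∖ N[v] of an edge av have the same size, so (with c = 2) the first one cannot be
-- dominated by the second when some w in the second shares a neighbour in N(a) with v.
-- This rules out k ≤ 2 a_ab and k ≤ 2 a_ad, and then forces u to have common neighbours
-- yP with b and yQ with d inside N(a).  Every vertex of N(u) ∖ N[a] is adjacent to yP or
-- yQ, which yields a_au + a_ayP = a_au + a_ayQ = ℓ, and counting around the common
-- neighbours of a, u, yP and yQ (or their absence) contradicts 3 (a_au + 1) ≤ ℓ.

module Submission where

import Algebra.Properties.CommutativeSemigroup
open import Data.Bool.Base using (Bool; true; false; _∧_; not)
open import Data.Bool.Properties using (¬-not; ∧-zeroʳ; ∧-identityʳ; ∧-comm)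
import Data.Bool.Properties as Bool
open import Data.Empty using (⊥; ⊥-elim)
open import Data.Fin.Base using (Fin; zero; suc)
open import Data.Fin.Properties using (_≟_; any?)
import Data.Fin.Properties as Fin
open import Data.List.Base using (List; []; _∷_; map)
open import Data.Nat.Base using (ℕ; zero; suc; _+_; _*_; _≤_; _<_; z≤n; s≤s; s≤s⁻¹)
open import Data.Nat.Properties
  using ( ≤-refl; ≤-reflexive; ≤-trans; <-trans; <-asym; <⇒≱; ≰⇒>; 1+n≰n; ≤ᵇ⇒≤
        ; n≤1+n; n<1+n; m≤m+n; m≤n+m; suc-injective
        ; +-comm; +-assoc; +-identityʳ; +-suc; +-mono-≤; +-monoˡ-≤; +-monoʳ-≤
        ; +-cancelˡ-≤; +-cancelʳ-≤; +-cancelˡ-≡; +-cancelʳ-≡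
        ; *-distribˡ-+; *-monoʳ-≤; *-cancelˡ-≤; +-commutativeSemigroup; module ≤-Reasoning )
open import Data.Nat.Tactic.RingSolver using (solve-∀)
open import Data.Product.Base using (∃-syntax; _×_; _,_; proj₁; proj₂)
open import Data.Sum.Base using (_⊎_; inj₁; inj₂; [_,_]′; swap)
open import Function.Base using (_∘_; case_of_)
open import Relation.Binary.PropositionalEquality
  using (_≡_; _≢_; refl; sym; trans; cong; cong₂; subst; subst₂; module ≡-Reasoning)
open import Relation.Nullary using (¬_; yes; no; does)
open import Relation.Nullary.Decidable using (dec-true; dec-false)

open Algebra.Properties.CommutativeSemigroup +-commutativeSemigroup using (interchange)

open import Defs hiding (_∼_)

-- Counting subsets of Fin n

[_] : Bool → ℕ
[ true ]  = 1
[ false ] = 0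

-- Unlike sum, ∑ adds no trailing 0, so sums over explicit lists of sets compute to the
-- expected shape.
∑ : List ℕ → ℕ
∑ []           = 0
∑ (x ∷ [])     = x
∑ (x ∷ y ∷ xs) = x + ∑ (y ∷ xs)

∑-∷ : ∀ x xs → ∑ (x ∷ xs) ≡ x + ∑ xs
∑-∷ x []       = sym (+-identityʳ x)
∑-∷ x (_ ∷ _) = refl

infix 8 #_
#_ : List Bool → ℕ
# bs = ∑ (map [_] bs)

∧-true⁻ : ∀ x {y} → x ∧ y ≡ true → x ≡ true × y ≡ true
∧-true⁻ true y≡true = refl , y≡true

∧-true⁺ : ∀ {x y} → x ≡ true → y ≡ true → x ∧ y ≡ true
∧-true⁺ refl refl = refl

∧-not⁺ : ∀ {x y} → x ≡ true → y ≡ false → x ∧ not y ≡ true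
∧-not⁺ refl refl = refl

true≢false : ∀ {x} → x ≡ true → x ≡ false → ⊥
true≢false refl ()

not-true⁻ : ∀ {x} → not x ≡ true → x ≡ false
not-true⁻ {false} _ = refl

sumFin-cong : ∀ {n} {f g : Fin n → ℕ} → (∀ i → f i ≡ g i) → sumFin n f ≡ sumFin n g
sumFin-cong {zero}  f≗g = refl
sumFin-cong {suc n} f≗g = cong₂ _+_ (f≗g zero) (sumFin-cong (f≗g ∘ suc))

sumFin-mono : ∀ {n} {f g : Fin n → ℕ} → (∀ i → f i ≤ g i) → sumFin n f ≤ sumFin n g
sumFin-mono {zero}  f≤g = z≤n
sumFin-mono {suc n} f≤g = +-mono-≤ (f≤g zero) (sumFin-mono (f≤g ∘ suc))

sumFin-zero : ∀ n → sumFin n (λ _ → 0) ≡ 0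
sumFin-zero zero    = refl
sumFin-zero (suc n) = sumFin-zero n

sumFin-+ : ∀ {n} (f g : Fin n → ℕ) → sumFin n (λ i → f i + g i) ≡ sumFin n f + sumFin n g
sumFin-+ {zero}  f g = refl
sumFin-+ {suc n} f g = trans (cong (f zero + g zero +_) (sumFin-+ (f ∘ suc) (g ∘ suc)))
                             (interchange (f zero) (g zero) _ _)

sumFin-comm : ∀ {m n} (f : Fin m → Fin n → ℕ) →
  sumFin m (λ i → sumFin n (f i)) ≡ sumFin n (λ j → sumFin m (λ i → f i j))
sumFin-comm {zero}  {n} f = sym (sumFin-zero n)
sumFin-comm {suc m} {n} f = trans (cong (sumFin n (f zero) +_) (sumFin-comm (f ∘ suc)))
                                  (sym (sumFin-+ (f zero) _))

sumFin-single : ∀ {n} {f : Fin n → ℕ} y → (∀ i → i ≢ y → f i ≡ 0) → sumFin n f ≡ f y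
sumFin-single {suc n} {f} zero vanish = trans
  (cong (f zero +_) (trans (sumFin-cong (λ i → vanish (suc i) λ ())) (sumFin-zero n)))
  (+-identityʳ (f zero))
sumFin-single {suc n} {f} (suc y) vanish = trans
  (cong (_+ sumFin n (f ∘ suc)) (vanish zero λ ()))
  (sumFin-single y (λ i i≢y → vanish (suc i) (i≢y ∘ Fin.suc-injective)))

sumFin-pair : ∀ {n} {f : Fin n → ℕ} {y₁ y₂} → y₁ ≢ y₂ →
  (∀ i → i ≢ y₁ → i ≢ y₂ → f i ≡ 0) → sumFin n f ≡ f y₁ + f y₂
sumFin-pair {y₁ = zero}   {zero}   y₁≢y₂ vanish = ⊥-elim (y₁≢y₂ refl)
sumFin-pair {f = f} {zero} {suc y₂} _ vanish =
  cong (f zero +_) (sumFin-single y₂ (λ i i≢y₂ → vanish (suc i) (λ ()) (i≢y₂ ∘ Fin.suc-injective)))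
sumFin-pair {f = f} {suc y₁} {zero} _ vanish = trans
  (cong (f zero +_) (sumFin-single y₁ (λ i i≢y₁ → vanish (suc i) (i≢y₁ ∘ Fin.suc-injective) (λ ()))))
  (+-comm (f zero) (f (suc y₁)))
sumFin-pair {suc n} {f} {suc y₁} {suc y₂} y₁≢y₂ vanish = trans
  (cong (_+ sumFin n (f ∘ suc)) (vanish zero (λ ()) (λ ())))
  (sumFin-pair (y₁≢y₂ ∘ cong suc)
    (λ i i≢y₁ i≢y₂ → vanish (suc i) (i≢y₁ ∘ Fin.suc-injective) (i≢y₂ ∘ Fin.suc-injective)))

Pred : ℕ → Set
Pred n = Fin n → Bool

module Subsets (n : ℕ) where

  infix  4 _∈_ _∉_ _⊆_
  infixl 7 _∩_ _∖_
  infix  9 _⟨_⟩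

  _∈_ _∉_ : Fin n → Pred n → Set
  v ∈ p = p v ≡ true
  v ∉ p = p v ≡ false

  _⊆_ : Pred n → Pred n → Set
  p ⊆ q = ∀ {v} → v ∈ p → v ∈ q

  _∩_ _∖_ : Pred n → Pred n → Pred n
  (p ∩ q) v = p v ∧ q v
  (p ∖ q) v = p v ∧ not (q v)

  ⁅_⁆ : Fin n → Pred n
  ⁅ y ⁆ v = does (v ≟ y)

  ∣_∣ : Pred n → ℕ
  ∣ p ∣ = sumFin n (λ v → [ p v ])

  ∑∣_∣ : List (Pred n) → ℕ
  ∑∣ ps ∣ = ∑ (map ∣_∣ ps)

  _⟨_⟩ : List (Pred n) → Fin n → List Bool
  ps ⟨ v ⟩ = map (λ p → p v) ps

  ∩⁻ : ∀ p q {v} → v ∈ p ∩ q → v ∈ p × v ∈ q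
  ∩⁻ p q {v} = ∧-true⁻ (p v)

  ∖⁻ : ∀ p q {v} → v ∈ p ∖ q → v ∈ p × v ∉ q
  ∖⁻ p q {v} v∈ with ∧-true⁻ (p v) v∈
  ... | v∈p , v∉q = v∈p , not-true⁻ v∉q

  ∈⁅⁆ : ∀ y → y ∈ ⁅ y ⁆
  ∈⁅⁆ y = dec-true (y ≟ y) refl

  ∉⁅⁆ : ∀ {v y} → v ≢ y → v ∉ ⁅ y ⁆
  ∉⁅⁆ {v} {y} = dec-false (v ≟ y)

  ∈⁅⁆⁻ : ∀ {v y} → v ∈ ⁅ y ⁆ → v ≡ y
  ∈⁅⁆⁻ {v} {y} v∈y with v ≟ y
  ... | yes v≡y = v≡y

  ∉⁅⁆⁻ : ∀ {v y} → v ∉ ⁅ y ⁆ → v ≢ y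
  ∉⁅⁆⁻ {v} v∉v refl = case trans (sym (∈⁅⁆ v)) v∉v of λ ()

  ∃-or-∅ : ∀ p → (∃[ v ] v ∈ p) ⊎ (∀ v → v ∉ p)
  ∃-or-∅ p with any? (λ v → p v Bool.≟ true)
  ... | yes v∈p = inj₁ v∈p
  ... | no  ∄   = inj₂ (λ v → ¬-not (λ v∈p → ∄ (v , v∈p)))

  ∣∣-cong : ∀ {p q} → (∀ v → p v ≡ q v) → ∣ p ∣ ≡ ∣ q ∣
  ∣∣-cong p≗q = sumFin-cong (cong [_] ∘ p≗q)

  ∣∣-mono : ∀ {p q} → p ⊆ q → ∣ p ∣ ≤ ∣ q ∣
  ∣∣-mono {p} {q} p⊆q = sumFin-mono pointwise
    where
    pointwise : ∀ v → [ p v ] ≤ [ q v ]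
    pointwise v with p v in v∈p
    ... | false = z≤n
    ... | true  rewrite p⊆q v∈p = ≤-refl

  ∣∅∣ : ∀ {p} → (∀ v → v ∉ p) → ∣ p ∣ ≡ 0
  ∣∅∣ {p} ∅ = trans (sumFin-cong (cong [_] ∘ ∅)) (sumFin-zero n)

  ∣⁅⁆∣ : ∀ y → ∣ ⁅ y ⁆ ∣ ≡ 1
  ∣⁅⁆∣ y = trans (sumFin-single y (λ i i≢y → cong [_] (∉⁅⁆ i≢y))) (cong [_] (∈⁅⁆ y))

  ∣∣-split : ∀ p q → ∣ p ∣ ≡ ∣ p ∩ q ∣ + ∣ p ∖ q ∣
  ∣∣-split p q = trans (sumFin-cong (λ v → split (p v) (q v))) (sumFin-+ {n} _ _)
    where
    split : ∀ x y → [ x ] ≡ [ x ∧ y ] + [ x ∧ not y ]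
    split true  true  = refl
    split true  false = refl
    split false _     = refl

  ∣∣-remove : ∀ {p y} → y ∈ p → ∣ p ∣ ≡ suc ∣ p ∖ ⁅ y ⁆ ∣
  ∣∣-remove {p} {y} y∈p = trans (∣∣-split p ⁅ y ⁆)
    (cong (_+ ∣ p ∖ ⁅ y ⁆ ∣) (trans (∣∣-cong only-y) (∣⁅⁆∣ y)))
    where
    only-y : ∀ v → p v ∧ does (v ≟ y) ≡ does (v ≟ y)
    only-y v with v ≟ y
    ... | yes refl = trans (∧-identityʳ (p v)) y∈p
    ... | no  _    = ∧-zeroʳ (p v)

  ∣∣-pos : ∀ {p v} → v ∈ p → 1 ≤ ∣ p ∣
  ∣∣-pos v∈p = subst (1 ≤_) (sym (∣∣-remove v∈p)) (s≤s z≤n)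

  ∣∣-witness : ∀ {p} → 1 ≤ ∣ p ∣ → ∃[ v ] v ∈ p
  ∣∣-witness {p} 1≤∣p∣ with ∃-or-∅ p
  ... | inj₁ v∈p = v∈p
  ... | inj₂ ∅   = ⊥-elim (1+n≰n (subst (1 ≤_) (∣∅∣ ∅) 1≤∣p∣))

  ∣∣≤1 : ∀ {p} → (∀ {i j} → i ∈ p → j ∈ p → i ≡ j) → ∣ p ∣ ≤ 1
  ∣∣≤1 {p} unique with ∃-or-∅ p
  ... | inj₂ ∅         = ≤-trans (≤-reflexive (∣∅∣ ∅)) z≤n
  ... | inj₁ (v , v∈p) = ≤-reflexive (trans (∣∣-remove v∈p) (cong suc (∣∅∣ only-v)))
    where
    only-v : ∀ i → i ∉ p ∖ ⁅ v ⁆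
    only-v i with p i in i∈p
    ... | false = refl
    ... | true  rewrite dec-true (i ≟ v) (unique i∈p v∈p) = refl

  ∣∣≥3 : ∀ {p x y z} → x ∈ p → y ∈ p → z ∈ p → x ≢ y → x ≢ z → y ≢ z → 3 ≤ ∣ p ∣
  ∣∣≥3 {p} {x} {y} {z} x∈p y∈p z∈p x≢y x≢z y≢z = begin
    3                             ≤⟨ s≤s (s≤s (∣∣-pos z∈p∖x∖y)) ⟩
    suc (suc ∣ p ∖ ⁅ x ⁆ ∖ ⁅ y ⁆ ∣) ≡⟨ cong suc (∣∣-remove y∈p∖x) ⟨
    suc ∣ p ∖ ⁅ x ⁆ ∣               ≡⟨ ∣∣-remove x∈p ⟨
    ∣ p ∣                           ∎
    where
    open ≤-Reasoning
    y∈p∖x : y ∈ p ∖ ⁅ x ⁆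
    y∈p∖x = ∧-not⁺ y∈p (∉⁅⁆ (x≢y ∘ sym))
    z∈p∖x∖y : z ∈ p ∖ ⁅ x ⁆ ∖ ⁅ y ⁆
    z∈p∖x∖y = ∧-not⁺ (∧-not⁺ z∈p (∉⁅⁆ (x≢z ∘ sym))) (∉⁅⁆ (y≢z ∘ sym))

  ∑∣∣-mono : ∀ ps qs → (∀ v → # ps ⟨ v ⟩ ≤ # qs ⟨ v ⟩) → ∑∣ ps ∣ ≤ ∑∣ qs ∣
  ∑∣∣-mono ps qs pointwise = subst₂ _≤_ (∑∣∣≡ ps) (∑∣∣≡ qs) (sumFin-mono pointwise)
    where
    ∑∣∣≡ : ∀ ps → sumFin n (λ v → # ps ⟨ v ⟩) ≡ ∑∣ ps ∣
    ∑∣∣≡ []       = sumFin-zero n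
    ∑∣∣≡ (p ∷ ps) = begin
      sumFin n (λ v → # (p ∷ ps) ⟨ v ⟩)
        ≡⟨ sumFin-cong (λ v → ∑-∷ [ p v ] (map [_] (ps ⟨ v ⟩))) ⟩
      sumFin n (λ v → [ p v ] + # ps ⟨ v ⟩)          ≡⟨ sumFin-+ {n} _ _ ⟩
      ∣ p ∣ + sumFin n (λ v → # ps ⟨ v ⟩)            ≡⟨ cong (∣ p ∣ +_) (∑∣∣≡ ps) ⟩
      ∣ p ∣ + ∑∣ ps ∣                                ≡⟨ ∑-∷ ∣ p ∣ (map ∣_∣ ps) ⟨
      ∑∣ p ∷ ps ∣                                    ∎
      where open ≡-Reasoning

  ∣∣-≤-via-partners : ∀ {p q} (R : Fin n → Pred n) →
    (∀ {z} → z ∈ p → ∃[ y ] y ∈ q × z ∈ R y) →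
    (∀ {y} → y ∈ q → ∣ R y ∩ p ∣ ≤ 1) →
    ∣ p ∣ ≤ ∣ q ∣
  ∣∣-≤-via-partners {p} {q} R partner few = begin
    sumFin n (λ z → [ p z ])                    ≤⟨ sumFin-mono lower ⟩
    sumFin n (λ z → ∣ (λ y → matched y z) ∣)   ≡⟨ sumFin-comm (λ z y → [ matched y z ]) ⟩
    sumFin n (λ y → ∣ matched y ∣)              ≤⟨ sumFin-mono upper ⟩
    sumFin n (λ y → [ q y ])                    ∎
    where
    open ≤-Reasoning
    matched : Fin n → Pred n
    matched y z = q y ∧ (R y ∩ p) z
    lower : ∀ z → [ p z ] ≤ ∣ (λ y → matched y z) ∣
    lower z with p z in z∈p
    ... | false = z≤n
    ... | true with partner z∈p
    ...   | y , y∈q , z∈Ry = ∣∣-pos {v = y} (∧-true⁺ y∈q (∧-true⁺ z∈Ry refl))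
    upper : ∀ y → ∣ matched y ∣ ≤ [ q y ]
    upper y with q y in y∈q
    ... | false = ≤-reflexive (∣∅∣ (λ _ → refl))
    ... | true  = few y∈q

countFin≡sumFin : ∀ n (p : Pred n) → countFin n p ≡ sumFin n (λ v → [ p v ])
countFin≡sumFin zero    p = refl
countFin≡sumFin (suc n) p with p zero
... | true  = cong suc (countFin≡sumFin n (p ∘ suc))
... | false = countFin≡sumFin n (p ∘ suc)

-- Linear arithmetic

small-part-bound : ∀ {s ℓ k} → s + ℓ < k → 3 * k ≤ 4 * ℓ → 3 * suc s ≤ ℓ
small-part-bound {s} {ℓ} {k} s+ℓ<k 3k≤4ℓ = +-cancelʳ-≤ (3 * ℓ) _ _ (begin
  3 * suc s + 3 * ℓ   ≡⟨ *-distribˡ-+ 3 (suc s) ℓ ⟨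
  3 * suc (s + ℓ)     ≤⟨ *-monoʳ-≤ 3 s+ℓ<k ⟩
  3 * k               ≤⟨ 3k≤4ℓ ⟩
  ℓ + 3 * ℓ           ∎)
  where open ≤-Reasoning

small-part-is-smaller : ∀ {s t ℓ} → s + t ≡ ℓ → 3 * suc s ≤ ℓ → s < t
small-part-is-smaller {s} {t} refl 3s+3≤s+t = ≤-trans (m≤n+m (suc s) (s + 2))
  (+-cancelˡ-≤ s _ _ (subst (_≤ s + t) (regroup s) 3s+3≤s+t))
  where
  regroup : ∀ s → 3 * suc s ≡ s + (s + 2 + suc s)
  regroup = solve-∀

large-part-bound : ∀ {s t ℓ} → s + t ≡ ℓ → 3 * suc s ≤ ℓ → 4 * ℓ + 6 ≤ 3 * (t + t)
large-part-bound {s} {t} refl 3s+3≤ℓ = +-cancelʳ-≤ (2 * s) _ _ (begin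
  4 * (s + t) + 6 + 2 * s   ≡⟨ regroup₁ s t ⟩
  2 * (3 * suc s) + 4 * t   ≤⟨ +-monoˡ-≤ (4 * t) (*-monoʳ-≤ 2 3s+3≤ℓ) ⟩
  2 * (s + t) + 4 * t       ≡⟨ regroup₂ s t ⟩
  3 * (t + t) + 2 * s       ∎)
  where
  open ≤-Reasoning
  regroup₁ : ∀ s t → 4 * (s + t) + 6 + 2 * s ≡ 2 * (3 * suc s) + 4 * t
  regroup₁ = solve-∀
  regroup₂ : ∀ s t → 2 * (s + t) + 4 * t ≡ 3 * (t + t) + 2 * s
  regroup₂ = solve-∀

degree<twice-large-part : ∀ {s t ℓ k} → s + t ≡ ℓ → 3 * suc s ≤ ℓ → 3 * k ≤ 4 * ℓ → suc k < t + t
degree<twice-large-part {s} {t} {ℓ} {k} s+t≡ℓ 3s+3≤ℓ 3k≤4ℓ = *-cancelˡ-≤ 3 (begin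
  3 * suc (suc k)   ≡⟨ *-distribˡ-+ 3 2 k ⟩
  6 + 3 * k         ≡⟨ +-comm 6 (3 * k) ⟩
  3 * k + 6         ≤⟨ +-monoˡ-≤ 6 3k≤4ℓ ⟩
  4 * ℓ + 6         ≤⟨ large-part-bound s+t≡ℓ 3s+3≤ℓ ⟩
  3 * (t + t)       ∎)
  where open ≤-Reasoning

small-parts<twice-large-part : ∀ {s s′ t ℓ} → s + t ≡ ℓ → 3 * suc s ≤ ℓ → 3 * suc s′ ≤ ℓ → s + s′ < t + t
small-parts<twice-large-part {s} {s′} {t} {ℓ} s+t≡ℓ 3s+3≤ℓ 3s′+3≤ℓ = *-cancelˡ-≤ 3 (begin
  3 * suc (s + s′)          ≤⟨ *-monoʳ-≤ 3 (s≤s (+-monoʳ-≤ s (n≤1+n s′))) ⟩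
  3 * (suc s + suc s′)      ≡⟨ *-distribˡ-+ 3 (suc s) (suc s′) ⟩
  3 * suc s + 3 * suc s′    ≤⟨ +-mono-≤ 3s+3≤ℓ 3s′+3≤ℓ ⟩
  ℓ + ℓ                     ≤⟨ +-monoʳ-≤ ℓ (m≤m+n ℓ (ℓ + (ℓ + 0))) ⟩
  4 * ℓ                     ≤⟨ m≤m+n (4 * ℓ) 6 ⟩
  4 * ℓ + 6                 ≤⟨ large-part-bound s+t≡ℓ 3s+3≤ℓ ⟩
  3 * (t + t)               ∎)
  where open ≤-Reasoning

-- Graphs

module _ {n : ℕ} (G : Graph n) where

  open Graph G
  open Subsets n

  infix 4 _∼_ _≁_

  _∼_ _≁_ : Fin n → Fin n → Set
  x ∼ y = adj x y ≡ true
  x ≁ y = adj x y ≡ false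

  Nonadjacent : Fin n → Fin n → Set
  Nonadjacent x z = x ≢ z × x ≁ z

  Common : Fin n → Fin n → Fin n → Set
  Common x z y = x ∼ y × z ∼ y

  N : Fin n → Pred n
  N = adj

  codeg : Fin n → Fin n → ℕ
  codeg x y = ∣ N x ∩ N y ∣

  infixl 7 _∖N[_]
  _∖N[_] : Pred n → Fin n → Pred n
  p ∖N[ a ] = p ∖ N a ∖ ⁅ a ⁆

  ∼-sym : ∀ {x y} → x ∼ y → y ∼ x
  ∼-sym {x} {y} = trans (symm y x)

  ≁-sym : ∀ {x y} → x ≁ y → y ≁ x
  ≁-sym {x} {y} = trans (symm y x)

  ¬∼⇒≁ : ∀ {x y} → ¬ x ∼ y → x ≁ y
  ¬∼⇒≁ = ¬-not

  ∼⇒≢ : ∀ {x y} → x ∼ y → x ≢ y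
  ∼⇒≢ {x} x∼x refl = case trans (sym x∼x) (irrefl x) of λ ()

  ∼-≁⇒≢ : ∀ {x y z} → x ∼ y → x ≁ z → y ≢ z
  ∼-≁⇒≢ x∼y x≁y refl = case trans (sym x∼y) x≁y of λ ()

  ∼-or-≁ : ∀ x y → x ∼ y ⊎ x ≁ y
  ∼-or-≁ x y with adj x y
  ... | true  = inj₁ refl
  ... | false = inj₂ refl

  Nonadjacent-sym : ∀ {x z} → Nonadjacent x z → Nonadjacent z x
  Nonadjacent-sym (x≢z , x≁z) = x≢z ∘ sym , ≁-sym x≁z

  codeg-comm : ∀ x y → codeg x y ≡ codeg y x
  codeg-comm x y = ∣∣-cong (λ v → ∧-comm (adj x v) (adj y v))

  common≡codeg : ∀ x y → common G x y ≡ codeg x y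
  common≡codeg x y = trans (countFin≡sumFin n _) (∣∣-cong (λ v → cong (adj x v ∧_) (symm v y)))

  Common⇒∈ : ∀ {x z y} → Common x z y → y ∈ N x ∩ N z
  Common⇒∈ (x∼y , z∼y) = ∧-true⁺ x∼y z∼y

  ∈⇒Common : ∀ {x z y} → y ∈ N x ∩ N z → Common x z y
  ∈⇒Common {x} {z} = ∩⁻ (N x) (N z)

  ∈N∩N∩N⁻ : ∀ {x y z v} → v ∈ N x ∩ N y ∩ N z → x ∼ v × y ∼ v × z ∼ v
  ∈N∩N∩N⁻ {x} {y} {z} v∈ with ∩⁻ (N x ∩ N y) (N z) v∈
  ... | v∈xy , z∼v = proj₁ (∈⇒Common v∈xy) , proj₂ (∈⇒Common v∈xy) , z∼v

  ∈N∖N[]⁺ : ∀ {v a z} → v ∼ z → a ≁ z → z ≢ a → z ∈ N v ∖N[ a ]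
  ∈N∖N[]⁺ v∼z a≁z z≢a = ∧-not⁺ (∧-not⁺ v∼z a≁z) (∉⁅⁆ z≢a)

  ∈N∖N[]⁻ : ∀ {v a z} → z ∈ N v ∖N[ a ] → v ∼ z × a ≁ z × z ≢ a
  ∈N∖N[]⁻ {v} {a} z∈ with ∖⁻ (N v ∖ N a) ⁅ a ⁆ z∈
  ... | z∈N∖N , z∉a with ∖⁻ (N v) (N a) z∈N∖N
  ...   | v∼z , a≁z = v∼z , a≁z , ∉⁅⁆⁻ z∉a

  -- The summand of ellSum is local to Defs, so it can only be reached through a witness.
  ellSum-summand : ∀ x z → ∃[ f ] ellSum G x z ≡ sumFin n f
  ellSum-summand x z = _ , refl

  summand-common : ∀ {x z y} → Common x z y → proj₁ (ellSum-summand x z) y ≡ codeg x y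
  summand-common {x} {z} {y} (x∼y , z∼y) rewrite ∼-sym x∼y | ∼-sym z∼y = common≡codeg x y

  summand-other : ∀ {x z y} → ¬ Common x z y → proj₁ (ellSum-summand x z) y ≡ 0
  summand-other {x} {z} {y} ¬common with adj y x in y∼x | adj y z in y∼z
  ... | true  | true  = ⊥-elim (¬common (∼-sym y∼x , ∼-sym y∼z))
  ... | true  | false = refl
  ... | false | _     = refl

  ellSum-two-common : ∀ {x z y₁ y₂} → y₁ ≢ y₂ → Common x z y₁ → Common x z y₂ →
    (∀ {y} → Common x z y → y ≡ y₁ ⊎ y ≡ y₂) → ellSum G x z ≡ codeg x y₁ + codeg x y₂
  ellSum-two-common {x} {z} {y₁} {y₂} y₁≢y₂ c₁ c₂ only = begin
    ellSum G x z         ≡⟨ proj₂ (ellSum-summand x z) ⟩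
    sumFin n f           ≡⟨ sumFin-pair y₁≢y₂ vanish ⟩
    f y₁ + f y₂          ≡⟨ cong₂ _+_ (summand-common c₁) (summand-common c₂) ⟩
    codeg x y₁ + codeg x y₂ ∎
    where
    open ≡-Reasoning
    f : Fin n → ℕ
    f = proj₁ (ellSum-summand x z)
    vanish : ∀ y → y ≢ y₁ → y ≢ y₂ → f y ≡ 0
    vanish y y≢y₁ y≢y₂ = summand-other λ c → [ y≢y₁ , y≢y₂ ]′ (only c)

  record Free (a b d u : Fin n) : Set where
    field
      a∼u : a ∼ u
      b≁u : b ≁ u
      d≁u : d ≁ u
      u≢b : u ≢ b
      u≢d : u ≢ d

    ub : Nonadjacent u b
    ub = u≢b , ≁-sym b≁u

    ud : Nonadjacent u d
    ud = u≢d , ≁-sym d≁u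

  Free-swap : ∀ {a b d u} → Free a b d u → Free a d b u
  Free-swap f = record { a∼u = a∼u ; b≁u = d≁u ; d≁u = b≁u ; u≢b = u≢d ; u≢d = u≢b }
    where open Free f

  module Regular {k : ℕ} (regular : ∀ x → ∣ N x ∣ ≡ k) where

    degree-split : ∀ {a v} → a ∼ v → k ≡ codeg a v + suc ∣ N v ∖N[ a ] ∣
    degree-split {a} {v} a∼v = begin
      k                                        ≡⟨ regular v ⟨
      ∣ N v ∣                                  ≡⟨ ∣∣-split (N v) (N a) ⟩
      codeg v a + ∣ N v ∖ N a ∣                ≡⟨ cong₂ _+_ (codeg-comm v a) (∣∣-remove a∈N∖N) ⟩
      codeg a v + suc ∣ N v ∖N[ a ] ∣          ∎
      where
      open ≡-Reasoning
      a∈N∖N : a ∈ N v ∖ N a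
      a∈N∖N = ∧-not⁺ (∼-sym a∼v) (irrefl a)

    exterior-≤⇒codeg-≥ : ∀ {a v w} → a ∼ v → a ∼ w →
      ∣ N v ∖N[ a ] ∣ ≤ ∣ N w ∖N[ a ] ∣ → codeg a w ≤ codeg a v
    exterior-≤⇒codeg-≥ {a} {v} {w} a∼v a∼w ext≤ = +-cancelʳ-≤ (suc ∣ N v ∖N[ a ] ∣) _ _ (begin
      codeg a w + suc ∣ N v ∖N[ a ] ∣   ≤⟨ +-monoʳ-≤ (codeg a w) (s≤s ext≤) ⟩
      codeg a w + suc ∣ N w ∖N[ a ] ∣   ≡⟨ degree-split a∼w ⟨
      k                                 ≡⟨ degree-split a∼v ⟩
      codeg a v + suc ∣ N v ∖N[ a ] ∣   ∎)
      where open ≤-Reasoning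

    exteriors-≤⇒codegs-≥ : ∀ {a v v′ w w′} → a ∼ v → a ∼ v′ → a ∼ w → a ∼ w′ →
      ∣ N v ∖N[ a ] ∣ + ∣ N v′ ∖N[ a ] ∣ ≤ ∣ N w ∖N[ a ] ∣ + ∣ N w′ ∖N[ a ] ∣ →
      codeg a w + codeg a w′ ≤ codeg a v + codeg a v′
    exteriors-≤⇒codegs-≥ {a} {v} {v′} {w} {w′} a∼v a∼v′ a∼w a∼w′ ext≤ =
      +-cancelʳ-≤ (suc (e v) + suc (e v′)) _ _ (begin
        codeg a w + codeg a w′ + (suc (e v) + suc (e v′))
          ≤⟨ +-monoʳ-≤ (codeg a w + codeg a w′)
               (subst₂ _≤_ (sucs (e v) (e v′)) (sucs (e w) (e w′)) (s≤s (s≤s ext≤))) ⟩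
        codeg a w + codeg a w′ + (suc (e w) + suc (e w′))
          ≡⟨ interchange (codeg a w) (codeg a w′) _ _ ⟩
        (codeg a w + suc (e w)) + (codeg a w′ + suc (e w′))
          ≡⟨ cong₂ _+_ (degree-split a∼w) (degree-split a∼w′) ⟨
        k + k
          ≡⟨ cong₂ _+_ (degree-split a∼v) (degree-split a∼v′) ⟩
        (codeg a v + suc (e v)) + (codeg a v′ + suc (e v′))
          ≡⟨ interchange (codeg a v) (suc (e v)) _ _ ⟩
        codeg a v + codeg a v′ + (suc (e v) + suc (e v′)) ∎)
      where
      open ≤-Reasoning
      e : Fin n → ℕ
      e x = ∣ N x ∖N[ a ] ∣
      sucs : ∀ x y → suc (suc (x + y)) ≡ suc x + suc y
      sucs x y = cong suc (sym (+-suc x y))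

    exterior-balanced : ∀ {a v} → a ∼ v → ∣ N v ∖N[ a ] ∣ ≡ ∣ N a ∖N[ v ] ∣
    exterior-balanced {a} {v} a∼v = suc-injective (+-cancelˡ-≡ (codeg a v) _ _ (begin
      codeg a v + suc ∣ N v ∖N[ a ] ∣   ≡⟨ degree-split a∼v ⟨
      k                                 ≡⟨ degree-split (∼-sym a∼v) ⟩
      codeg v a + suc ∣ N a ∖N[ v ] ∣   ≡⟨ cong (_+ suc ∣ N a ∖N[ v ] ∣) (codeg-comm v a) ⟩
      codeg a v + suc ∣ N a ∖N[ v ] ∣   ∎))
      where open ≡-Reasoning

  module CoEdgeRegular₂ {k : ℕ} (regular : ∀ x → ∣ N x ∣ ≡ k)
    (codeg≡2 : ∀ {x z} → Nonadjacent x z → codeg x z ≡ 2) where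

    open Regular regular public

    no-third-common : ∀ {x z y₁ y₂ y₃} → Nonadjacent x z →
      Common x z y₁ → Common x z y₂ → Common x z y₃ → y₁ ≢ y₂ → y₁ ≢ y₃ → y₂ ≢ y₃ → ⊥
    no-third-common xz c₁ c₂ c₃ y₁≢y₂ y₁≢y₃ y₂≢y₃ = 1+n≰n (subst (3 ≤_) (codeg≡2 xz)
      (∣∣≥3 (Common⇒∈ c₁) (Common⇒∈ c₂) (Common⇒∈ c₃) y₁≢y₂ y₁≢y₃ y₂≢y₃))

    second-common : ∀ {x z y₁} → Nonadjacent x z → Common x z y₁ →
      ∃[ y₂ ] Common x z y₂ × y₂ ≢ y₁
    second-common {x} {z} {y₁} xz c₁ with ∣∣-witness {p = N x ∩ N z ∖ ⁅ y₁ ⁆} one-more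
      where
      one-more : 1 ≤ ∣ N x ∩ N z ∖ ⁅ y₁ ⁆ ∣
      one-more = s≤s⁻¹ (≤-reflexive (trans (sym (codeg≡2 xz)) (∣∣-remove (Common⇒∈ c₁))))
    ... | y₂ , y₂∈ with ∖⁻ (N x ∩ N z) ⁅ y₁ ⁆ y₂∈
    ...   | common , y₂∉y₁ = y₂ , ∈⇒Common common , ∉⁅⁆⁻ y₂∉y₁

    common-cases : ∀ {x z y₁ y₂ y} → Nonadjacent x z → Common x z y₁ → Common x z y₂ →
      y₁ ≢ y₂ → Common x z y → y ≡ y₁ ⊎ y ≡ y₂
    common-cases {y₁ = y₁} {y₂} {y} xz c₁ c₂ y₁≢y₂ c with y ≟ y₁ | y ≟ y₂
    ... | yes y≡y₁ | _        = inj₁ y≡y₁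
    ... | no  _    | yes y≡y₂ = inj₂ y≡y₂
    ... | no  y≢y₁ | no  y≢y₂ = ⊥-elim (no-third-common xz c₁ c₂ c y₁≢y₂ (y≢y₁ ∘ sym) (y≢y₂ ∘ sym))

    ∣∣≤1-other-common : ∀ {p x z w} → Nonadjacent x z → Common x z w →
      (∀ {v} → v ∈ p → Common x z v × v ≢ w) → ∣ p ∣ ≤ 1
    ∣∣≤1-other-common {p} xz c-w other = ∣∣≤1 unique
      where
      unique : ∀ {i j} → i ∈ p → j ∈ p → i ≡ j
      unique {i} {j} i∈p j∈p with i ≟ j | other i∈p | other j∈p
      ... | yes i≡j | _ | _ = i≡j
      ... | no  i≢j | c-i , i≢w | c-j , j≢w =
        ⊥-elim (no-third-common xz c-w c-i c-j (i≢w ∘ sym) (j≢w ∘ sym) i≢j)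

    codeg-pair-bound : ∀ {a y y′} → a ∼ y → a ∼ y′ → Nonadjacent y y′ →
      codeg a y + codeg a y′ < k
    codeg-pair-bound {a} {y} {y′} a∼y a∼y′ yy′@(y≢y′ , y≁y′) = begin-strict
      codeg a y + codeg a y′         ≤⟨ ∑∣∣-mono (N a ∩ N y ∷ N a ∩ N y′ ∷ [])
                                                  (N a ∖ ⁅ y ⁆ ∖ ⁅ y′ ⁆ ∷ N a ∩ N y ∩ N y′ ∷ [])
                                                  pointwise ⟩
      ∣ N a ∖ ⁅ y ⁆ ∖ ⁅ y′ ⁆ ∣ + ∣ N a ∩ N y ∩ N y′ ∣
        ≤⟨ +-monoʳ-≤ _ (∣∣≤1-other-common yy′ (∼-sym a∼y , ∼-sym a∼y′) other) ⟩
      ∣ N a ∖ ⁅ y ⁆ ∖ ⁅ y′ ⁆ ∣ + 1    ≡⟨ +-comm _ 1 ⟩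
      suc ∣ N a ∖ ⁅ y ⁆ ∖ ⁅ y′ ⁆ ∣    <⟨ n<1+n _ ⟩
      suc (suc ∣ N a ∖ ⁅ y ⁆ ∖ ⁅ y′ ⁆ ∣) ≡⟨ cong suc (∣∣-remove (∧-not⁺ a∼y′ (∉⁅⁆ (y≢y′ ∘ sym)))) ⟨
      suc ∣ N a ∖ ⁅ y ⁆ ∣             ≡⟨ ∣∣-remove a∼y ⟨
      ∣ N a ∣                         ≡⟨ regular a ⟩
      k                               ∎
      where
      open ≤-Reasoning
      other : ∀ {v} → v ∈ N a ∩ N y ∩ N y′ → Common y y′ v × v ≢ a
      other v∈ with ∈N∩N∩N⁻ v∈
      ... | a∼v , y∼v , y′∼v = (y∼v , y′∼v) , ∼⇒≢ a∼v ∘ sym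
      tally : ∀ A Y Y′ E E′ → (Y ≡ true ⊎ Y′ ≡ true → E ≡ false × E′ ≡ false) →
        # (A ∧ Y ∷ A ∧ Y′ ∷ []) ≤ # ((A ∧ not E) ∧ not E′ ∷ (A ∧ Y) ∧ Y′ ∷ [])
      tally false _     _     _ _ _ = z≤n
      tally true  false false _ _ _ = z≤n
      tally true  true  Y′    E E′ distinct with distinct (inj₁ refl)
      ... | refl , refl = ≤-refl
      tally true  false true  E E′ distinct with distinct (inj₂ refl)
      ... | refl , refl = s≤s z≤n
      pointwise : ∀ v → # (N a ∩ N y ∷ N a ∩ N y′ ∷ []) ⟨ v ⟩
                      ≤ # (N a ∖ ⁅ y ⁆ ∖ ⁅ y′ ⁆ ∷ N a ∩ N y ∩ N y′ ∷ []) ⟨ v ⟩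
      pointwise v = tally (adj a v) (adj y v) (adj y′ v) _ _ distinct
        where
        distinct : y ∼ v ⊎ y′ ∼ v → v ∉ ⁅ y ⁆ × v ∉ ⁅ y′ ⁆
        distinct (inj₁ y∼v)  = ∉⁅⁆ (∼⇒≢ y∼v ∘ sym) , ∉⁅⁆ (∼-≁⇒≢ y∼v y≁y′)
        distinct (inj₂ y′∼v) = ∉⁅⁆ (∼-≁⇒≢ y′∼v (≁-sym y≁y′)) , ∉⁅⁆ (∼⇒≢ y′∼v ∘ sym)

    -- w sees no vertex of N v ∖N[ a ] (v and w already share a and y₀) and every other
    -- y ∈ N a ∖N[ v ] sees at most one, whereas exterior-balanced makes both sets equally large.
    exterior-undominated : ∀ {a v w y₀} → a ∼ v → w ∈ N a ∖N[ v ] → Common v w y₀ → a ∼ y₀ →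
      (∀ {z} → z ∈ N v ∖N[ a ] → ∃[ y ] y ∈ N a ∖N[ v ] × y ∼ z) → ⊥
    exterior-undominated {a} {v} {w} {y₀} a∼v w∈ c₀ a∼y₀ dominated = 1+n≰n (begin
      suc ∣ N a ∖N[ v ] ∖ ⁅ w ⁆ ∣   ≡⟨ ∣∣-remove w∈ ⟨
      ∣ N a ∖N[ v ] ∣               ≡⟨ exterior-balanced a∼v ⟨
      ∣ N v ∖N[ a ] ∣               ≤⟨ ∣∣-≤-via-partners N partner few ⟩
      ∣ N a ∖N[ v ] ∖ ⁅ w ⁆ ∣       ∎)
      where
      open ≤-Reasoning
      vw : Nonadjacent v w
      vw with ∈N∖N[]⁻ w∈
      ... | _ , v≁w , w≢v = w≢v ∘ sym , v≁w
      partner : ∀ {z} → z ∈ N v ∖N[ a ] → ∃[ y ] y ∈ N a ∖N[ v ] ∖ ⁅ w ⁆ × y ∼ z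
      partner z∈ with dominated z∈ | ∈N∖N[]⁻ z∈
      ... | y , y∈ , y∼z | v∼z , a≁z , z≢a = y , ∧-not⁺ y∈ (∉⁅⁆ y≢w) , y∼z
        where
        y≢w : y ≢ w
        y≢w refl = no-third-common vw c₀ (∼-sym a∼v , ∼-sym (proj₁ (∈N∖N[]⁻ w∈))) (v∼z , y∼z)
                     (∼⇒≢ a∼y₀ ∘ sym) (∼-≁⇒≢ a∼y₀ a≁z) (z≢a ∘ sym)
      few : ∀ {y} → y ∈ N a ∖N[ v ] ∖ ⁅ w ⁆ → ∣ N y ∩ (N v ∖N[ a ]) ∣ ≤ 1
      few {y} y∈ with ∈N∖N[]⁻ (proj₁ (∖⁻ (N a ∖N[ v ]) ⁅ w ⁆ y∈))
      ... | a∼y , v≁y , y≢v = ∣∣≤1-other-common (y≢v ∘ sym , v≁y) (∼-sym a∼v , ∼-sym a∼y) other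
        where
        other : ∀ {z} → z ∈ N y ∩ (N v ∖N[ a ]) → Common v y z × z ≢ a
        other z∈ with ∩⁻ (N y) (N v ∖N[ a ]) z∈
        ... | y∼z , z∈′ with ∈N∖N[]⁻ z∈′
        ...   | v∼z , _ , z≢a = (v∼z , y∼z) , z≢a

  module StronglyCoEdgeRegular₂ {k ℓ : ℕ} (regular : ∀ x → ∣ N x ∣ ≡ k)
    (codeg≡2 : ∀ {x z} → Nonadjacent x z → codeg x z ≡ 2)
    (ellSum≡ℓ : ∀ {x z} → Nonadjacent x z → ellSum G x z ≡ ℓ) where

    open CoEdgeRegular₂ regular codeg≡2 public

    ℓ-split : ∀ {x z y₁ y₂} → Nonadjacent x z → Common x z y₁ → Common x z y₂ → y₁ ≢ y₂ →
      codeg x y₁ + codeg x y₂ ≡ ℓ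
    ℓ-split xz c₁ c₂ y₁≢y₂ =
      trans (sym (ellSum-two-common y₁≢y₂ c₁ c₂ (common-cases xz c₁ c₂ y₁≢y₂))) (ellSum≡ℓ xz)

    -- The induced quadrangle

    module Quadrangle (3k≤4ℓ : 3 * k ≤ 4 * ℓ) (ℓ+3≤k : ℓ + 3 ≤ k)
      {a b c d} (a∼b : a ∼ b) (b∼c : b ∼ c) (c∼d : c ∼ d) (d∼a : d ∼ a)
      (ac : Nonadjacent a c) (bd : Nonadjacent b d) where

      a∼d : a ∼ d
      a∼d = ∼-sym d∼a

      codeg-ab+ad : codeg a b + codeg a d ≡ ℓ
      codeg-ab+ad = ℓ-split ac (a∼b , ∼-sym b∼c) (a∼d , c∼d) (proj₁ bd)

      no-common-abd : ∀ {v} → a ∼ v → b ∼ v → d ∼ v → ⊥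
      no-common-abd a∼v b∼v d∼v = no-third-common bd (∼-sym a∼b , d∼a) (b∼c , ∼-sym c∼d) (b∼v , d∼v)
        (proj₁ ac) (∼⇒≢ a∼v) (∼-≁⇒≢ a∼v (proj₂ ac) ∘ sym)

      free-count : 1 ≤ ∣ N a ∖ N b ∖ N d ∖ ⁅ b ⁆ ∖ ⁅ d ⁆ ∣
      free-count = s≤s⁻¹ (s≤s⁻¹ (+-cancelˡ-≤ ℓ 3 _ (begin
        ℓ + 3                                   ≤⟨ ℓ+3≤k ⟩
        k                                       ≡⟨ regular a ⟨
        ∣ N a ∣                                 ≤⟨ ∑∣∣-mono (N a ∷ []) parts pointwise ⟩
        codeg a b + (codeg a d + (∣ ⁅ b ⁆ ∣ + (∣ ⁅ d ⁆ ∣ + ∣ R ∣)))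
          ≡⟨ cong (λ m → codeg a b + (codeg a d + m)) (cong₂ _+_ (∣⁅⁆∣ b) (cong (_+ ∣ R ∣) (∣⁅⁆∣ d))) ⟩
        codeg a b + (codeg a d + (2 + ∣ R ∣))   ≡⟨ +-assoc (codeg a b) _ _ ⟨
        codeg a b + codeg a d + (2 + ∣ R ∣)     ≡⟨ cong (_+ (2 + ∣ R ∣)) codeg-ab+ad ⟩
        ℓ + (2 + ∣ R ∣)                         ∎)))
        where
        open ≤-Reasoning
        R : Pred n
        R = N a ∖ N b ∖ N d ∖ ⁅ b ⁆ ∖ ⁅ d ⁆
        parts : List (Pred n)
        parts = N a ∩ N b ∷ N a ∩ N d ∷ ⁅ b ⁆ ∷ ⁅ d ⁆ ∷ R ∷ []
        tally : ∀ A B D E E′ →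
          # (A ∷ []) ≤ # (A ∧ B ∷ A ∧ D ∷ E ∷ E′ ∷ (((A ∧ not B) ∧ not D) ∧ not E) ∧ not E′ ∷ [])
        tally false _     _     _     _     = z≤n
        tally true  true  _     _     _     = s≤s z≤n
        tally true  false true  _     _     = s≤s z≤n
        tally true  false false true  _     = s≤s z≤n
        tally true  false false false true  = s≤s z≤n
        tally true  false false false false = s≤s z≤n
        pointwise : ∀ v → # (N a ∷ []) ⟨ v ⟩ ≤ # parts ⟨ v ⟩
        pointwise v = tally (adj a v) (adj b v) (adj d v) (⁅ b ⁆ v) (⁅ d ⁆ v)

      free-exists : ∃[ u ] Free a b d u
      free-exists with ∣∣-witness free-count
      ... | u , u∈R with ∖⁻ (N a ∖ N b ∖ N d ∖ ⁅ b ⁆) ⁅ d ⁆ u∈R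
      ... | u∈₄ , u∉d with ∖⁻ (N a ∖ N b ∖ N d) ⁅ b ⁆ u∈₄
      ... | u∈₃ , u∉b with ∖⁻ (N a ∖ N b) (N d) u∈₃
      ... | u∈₂ , d≁u with ∖⁻ (N a) (N b) u∈₂
      ... | a∼u , b≁u = u , record
        { a∼u = a∼u ; b≁u = b≁u ; d≁u = d≁u ; u≢b = ∉⁅⁆⁻ u∉b ; u≢d = ∉⁅⁆⁻ u∉d }

      free-cover : ∀ {u} → Free a b d u →
        ∑∣ N a ∩ N b ∷ N a ∩ N d ∷ ⁅ b ⁆ ∷ ⁅ d ⁆ ∷ N a ∩ N u ∷ ⁅ u ⁆ ∷ [] ∣
          ≤ ∑∣ N a ∷ N a ∩ N b ∩ N u ∷ N a ∩ N d ∩ N u ∷ [] ∣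
      free-cover {u} f = ∑∣∣-mono (N a ∩ N b ∷ N a ∩ N d ∷ ⁅ b ⁆ ∷ ⁅ d ⁆ ∷ N a ∩ N u ∷ ⁅ u ⁆ ∷ [])
                                  (N a ∷ N a ∩ N b ∩ N u ∷ N a ∩ N d ∩ N u ∷ []) pointwise
        where
        open Free f
        Isolated : Bool → Bool → Bool → Bool → Bool → Bool → Set
        Isolated A B D U E E′ = A ≡ true × B ≡ false × D ≡ false × U ≡ false × E ≡ false × E′ ≡ false
        tally : ∀ A B D U Eb Ed Eu → (A ≡ true → B ≡ true → D ≡ true → ⊥) →
          (Eb ≡ true → Isolated A B D U Ed Eu) → (Ed ≡ true → Isolated A B D U Eb Eu) →
          (Eu ≡ true → Isolated A B D U Eb Ed) →
          # (A ∧ B ∷ A ∧ D ∷ Eb ∷ Ed ∷ A ∧ U ∷ Eu ∷ []) ≤ # (A ∷ (A ∧ B) ∧ U ∷ (A ∧ D) ∧ U ∷ [])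
        tally _ _ _ _ true _ _ _ at-b _ _ with at-b refl
        ... | refl , refl , refl , refl , refl , refl = ≤ᵇ⇒≤ _ _ _
        tally _ _ _ _ false true _ _ _ at-d _ with at-d refl
        ... | refl , refl , refl , refl , refl , refl = ≤ᵇ⇒≤ _ _ _
        tally _ _ _ _ false false true _ _ _ at-u with at-u refl
        ... | refl , refl , refl , refl , refl , refl = ≤ᵇ⇒≤ _ _ _
        tally false _     _     _     false false false _ _ _ _ = z≤n
        tally true  true  true  _     false false false abd _ _ _ = ⊥-elim (abd refl refl refl)
        tally true  true  false true  false false false _ _ _ _ = ≤-refl
        tally true  true  false false false false false _ _ _ _ = ≤-refl
        tally true  false true  true  false false false _ _ _ _ = ≤-refl
        tally true  false true  false false false false _ _ _ _ = ≤-refl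
        tally true  false false true  false false false _ _ _ _ = ≤-refl
        tally true  false false false false false false _ _ _ _ = z≤n
        pointwise : ∀ v → # (N a ∩ N b ∷ N a ∩ N d ∷ ⁅ b ⁆ ∷ ⁅ d ⁆ ∷ N a ∩ N u ∷ ⁅ u ⁆ ∷ []) ⟨ v ⟩
                        ≤ # (N a ∷ N a ∩ N b ∩ N u ∷ N a ∩ N d ∩ N u ∷ []) ⟨ v ⟩
        pointwise v = tally (adj a v) (adj b v) (adj d v) (adj u v) (⁅ b ⁆ v) (⁅ d ⁆ v) (⁅ u ⁆ v)
          no-common-abd at-b at-d at-u
          where
          at-b : v ∈ ⁅ b ⁆ → Isolated (adj a v) (adj b v) (adj d v) (adj u v) (⁅ d ⁆ v) (⁅ u ⁆ v)
          at-b v∈ with ∈⁅⁆⁻ {v} {b} v∈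
          ... | refl = a∼b , irrefl b , ≁-sym (proj₂ bd) , ≁-sym b≁u , ∉⁅⁆ (proj₁ bd) , ∉⁅⁆ (u≢b ∘ sym)
          at-d : v ∈ ⁅ d ⁆ → Isolated (adj a v) (adj b v) (adj d v) (adj u v) (⁅ b ⁆ v) (⁅ u ⁆ v)
          at-d v∈ with ∈⁅⁆⁻ {v} {d} v∈
          ... | refl = a∼d , proj₂ bd , irrefl d , ≁-sym d≁u , ∉⁅⁆ (proj₁ bd ∘ sym) , ∉⁅⁆ (u≢d ∘ sym)
          at-u : v ∈ ⁅ u ⁆ → Isolated (adj a v) (adj b v) (adj d v) (adj u v) (⁅ b ⁆ v) (⁅ d ⁆ v)
          at-u v∈ with ∈⁅⁆⁻ {v} {u} v∈
          ... | refl = a∼u , b≁u , d≁u , irrefl u , ∉⁅⁆ u≢b , ∉⁅⁆ u≢d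

      free-bound : ∀ {u} → Free a b d u → codeg a u + ℓ < k
      free-bound {u} f = +-cancelʳ-≤ 2 _ _ (begin
        suc (codeg a u + ℓ) + 2
          ≡⟨ cong (λ m → suc (codeg a u + m) + 2) codeg-ab+ad ⟨
        suc (codeg a u + (codeg a b + codeg a d)) + 2
          ≡⟨ regroup (codeg a b) (codeg a d) (codeg a u) ⟩
        codeg a b + (codeg a d + (1 + (1 + (codeg a u + 1))))
          ≡⟨ cong (λ m → codeg a b + (codeg a d + m))
               (cong₂ _+_ (∣⁅⁆∣ b) (cong₂ _+_ (∣⁅⁆∣ d) (cong (codeg a u +_) (∣⁅⁆∣ u)))) ⟨
        ∑∣ N a ∩ N b ∷ N a ∩ N d ∷ ⁅ b ⁆ ∷ ⁅ d ⁆ ∷ N a ∩ N u ∷ ⁅ u ⁆ ∷ [] ∣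
          ≤⟨ free-cover f ⟩
        ∣ N a ∣ + (∣ N a ∩ N b ∩ N u ∣ + ∣ N a ∩ N d ∩ N u ∣)
          ≤⟨ +-mono-≤ (≤-reflexive (regular a)) (+-mono-≤ (few ub a∼b) (few ud a∼d)) ⟩
        k + 2 ∎)
        where
        open ≤-Reasoning
        open Free f
        regroup : ∀ p q c → suc (c + (p + q)) + 2 ≡ p + (q + (1 + (1 + (c + 1))))
        regroup = solve-∀
        few : ∀ {x} → Nonadjacent u x → a ∼ x → ∣ N a ∩ N x ∩ N u ∣ ≤ 1
        few {x} ux a∼x = ∣∣≤1-other-common ux (∼-sym a∼u , ∼-sym a∼x) other
          where
          other : ∀ {v} → v ∈ N a ∩ N x ∩ N u → Common u x v × v ≢ a
          other v∈ with ∈N∩N∩N⁻ v∈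
          ... | a∼v , x∼v , u∼v = (u∼v , x∼v) , ∼⇒≢ a∼v ∘ sym

      free-small : ∀ {u} → Free a b d u → 3 * suc (codeg a u) ≤ ℓ
      free-small f = small-part-bound (free-bound f) 3k≤4ℓ

      -- If k ≤ 2 a_ab, codeg-pair-bound makes every y ∈ N(a) with a_ay = a_ab adjacent to b.
      -- The second common neighbour of a with any z ∈ N(d) ∖ N[a] has that codegree, so
      -- N(d) ∖ N[a] is dominated by N(a) ∖ N[d], against exterior-undominated.
      module LargeCodegree (k≤2ab : k ≤ codeg a b + codeg a b) where

        not-twin : ∀ {y} → a ∼ y → Nonadjacent b y → codeg a y ≡ codeg a b → ⊥
        not-twin a∼y by eq =
          <⇒≱ (subst (λ m → codeg a b + m < k) eq (codeg-pair-bound a∼b a∼y by)) k≤2ab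

        twin : ∀ {y} → codeg a y + codeg a d ≡ ℓ → codeg a y ≡ codeg a b
        twin eq = +-cancelʳ-≡ (codeg a d) _ _ (trans eq (sym codeg-ab+ad))

        dominated : ∀ {z} → z ∈ N d ∖N[ a ] → ∃[ y ] y ∈ N a ∖N[ d ] × y ∼ z
        dominated z∈ with ∈N∖N[]⁻ z∈
        ... | d∼z , a≁z , z≢a with second-common (z≢a ∘ sym , a≁z) (a∼d , ∼-sym d∼z)
        ... | y , (a∼y , z∼y) , y≢d with y ≟ b | ∼-or-≁ b y
        ...   | yes refl | _         = b , ∈N∖N[]⁺ a∼b (≁-sym (proj₂ bd)) (proj₁ bd) , ∼-sym z∼y
        ...   | no  y≢b  | inj₁ b∼y = y , ∈N∖N[]⁺ a∼y (¬∼⇒≁ (no-common-abd a∼y b∼y)) y≢d , ∼-sym z∼y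
        ...   | no  y≢b  | inj₂ b≁y = ⊥-elim (not-twin a∼y (y≢b ∘ sym , b≁y)
                  (twin (ℓ-split (z≢a ∘ sym , a≁z) (a∼y , z∼y) (a∼d , ∼-sym d∼z) y≢d)))

        no-free : ∀ {u} → Free a b d u → ⊥
        no-free {u} f with second-common (Free.ud f) (∼-sym (Free.a∼u f) , d∼a)
        ... | w , (u∼w , d∼w) , w≢a = [ inside , outside ]′ (∼-or-≁ a w)
          where
          open Free f
          inside : a ∼ w → ⊥
          inside a∼w = exterior-undominated a∼d (∈N∖N[]⁺ a∼u d≁u u≢d) (d∼w , u∼w) a∼w dominated
          outside : a ≁ w → ⊥
          outside a≁w = not-twin a∼u (u≢b ∘ sym , b≁u)
            (twin (ℓ-split (w≢a ∘ sym , a≁w) (a∼u , ∼-sym u∼w) (a∼d , ∼-sym d∼w) u≢d))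

      codeg-ab-bound : codeg a b + codeg a b < k
      codeg-ab-bound = ≰⇒> (λ k≤2ab → LargeCodegree.no-free k≤2ab (proj₂ free-exists))

      meets-b : ∀ {u} → Free a b d u → ∃[ y ] Common a b y × u ∼ y
      meets-b {u} f with second-common (Free.ub f) (∼-sym (Free.a∼u f) , ∼-sym a∼b)
      ... | w , (u∼w , b∼w) , w≢a with ∼-or-≁ a w
      ... | inj₁ a∼w = w , (a∼w , b∼w) , u∼w
      ... | inj₂ a≁w = ⊥-elim (<-asym codeg-ab-bound (<-trans (n<1+n k)
              (degree<twice-large-part (trans (+-comm (codeg a d) (codeg a b)) codeg-ab+ad)
                (subst (λ m → 3 * suc m ≤ ℓ) au≡ad (free-small f)) 3k≤4ℓ)))
        where
        au≡ad : codeg a u ≡ codeg a d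
        au≡ad = +-cancelʳ-≡ (codeg a b) _ _ (trans
          (ℓ-split (w≢a ∘ sym , a≁w) (Free.a∼u f , ∼-sym u∼w) (a∼b , ∼-sym b∼w) (Free.u≢b f))
          (trans (sym codeg-ab+ad) (+-comm (codeg a b) (codeg a d))))

      exterior-nonempty : ∀ {u} → Free a b d u → ∃[ z ] z ∈ N u ∖N[ a ]
      exterior-nonempty {u} f = ∣∣-witness (≤-trans (≤-trans (s≤s z≤n) (free-small f)) ℓ≤ext)
        where
        open ≤-Reasoning
        ℓ≤ext : ℓ ≤ ∣ N u ∖N[ a ] ∣
        ℓ≤ext = s≤s⁻¹ (+-cancelˡ-≤ (codeg a u) _ _ (begin
          codeg a u + suc ℓ              ≡⟨ +-suc (codeg a u) ℓ ⟩
          suc (codeg a u + ℓ)            ≤⟨ free-bound f ⟩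
          k                              ≡⟨ degree-split (Free.a∼u f) ⟩
          codeg a u + suc ∣ N u ∖N[ a ] ∣ ∎))

      module Meeting {yP yQ} (ab-yP : Common a b yP) (ad-yQ : Common a d yQ) where

        a∼yP : a ∼ yP
        a∼yP = proj₁ ab-yP

        a∼yQ : a ∼ yQ
        a∼yQ = proj₁ ad-yQ

        yP≢yQ : yP ≢ yQ
        yP≢yQ = ∼-≁⇒≢ (proj₂ ab-yP) (¬∼⇒≁ (λ b∼yQ → no-common-abd a∼yQ b∼yQ (proj₂ ad-yQ)))

        -- Otherwise N(u) ∖ N[a] would be dominated by N(a) ∖ N[u] ∋ b: if u ∼ y′ for the second
        -- common neighbour y′ of a with some z′ ∈ N(u) ∖ N[a], then y′ is a third common
        -- neighbour of u and y, or y and y′ are non-adjacent neighbours of a of codegree ℓ − a_au.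
        second-adjacent : ∀ {u z y} → Free a b d u → u ∼ yP → Nonadjacent a z →
          Common a z u → Common a z y → y ≢ u → u ∼ y
        second-adjacent {u} {z} {y} f u∼yP az c-u c-y y≢u with ∼-or-≁ u y
        ... | inj₁ u∼y = u∼y
        ... | inj₂ u≁y = ⊥-elim (exterior-undominated a∼u (∈N∖N[]⁺ a∼b (≁-sym b≁u) (u≢b ∘ sym))
                           (u∼yP , proj₂ ab-yP) a∼yP dominated)
          where
          open Free f
          ℓ≡ : codeg a u + codeg a y ≡ ℓ
          ℓ≡ = ℓ-split az c-u c-y (y≢u ∘ sym)
          dominated : ∀ {z′} → z′ ∈ N u ∖N[ a ] → ∃[ y′ ] y′ ∈ N a ∖N[ u ] × y′ ∼ z′
          dominated z′∈ with ∈N∖N[]⁻ z′∈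
          ... | u∼z′ , a≁z′ , z′≢a with second-common (z′≢a ∘ sym , a≁z′) (a∼u , ∼-sym u∼z′)
          ... | y′ , (a∼y′ , z′∼y′) , y′≢u with ∼-or-≁ u y′
          ...   | inj₂ u≁y′ = y′ , ∈N∖N[]⁺ a∼y′ u≁y′ y′≢u , ∼-sym z′∼y′
          ...   | inj₁ u∼y′ with ∼-or-≁ y y′
          ...     | inj₁ y∼y′ = ⊥-elim (no-third-common (y≢u ∘ sym , u≁y)
                       (∼-sym a∼u , ∼-sym (proj₁ c-y)) (∼-sym (proj₂ c-u) , ∼-sym (proj₂ c-y))
                       (u∼y′ , y∼y′)
                       (proj₁ az) (∼⇒≢ a∼y′) (∼-≁⇒≢ a∼y′ (proj₂ az) ∘ sym))
          ...     | inj₂ y≁y′ = ⊥-elim (<-asym pair (<-trans (n<1+n k)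
                                    (degree<twice-large-part ℓ≡ (free-small f) 3k≤4ℓ)))
            where
            y′≡y : codeg a y′ ≡ codeg a y
            y′≡y = +-cancelˡ-≡ (codeg a u) _ _
              (trans (ℓ-split (z′≢a ∘ sym , a≁z′) (a∼u , ∼-sym u∼z′) (a∼y′ , z′∼y′) (y′≢u ∘ sym))
                     (sym ℓ≡))
            pair : codeg a y + codeg a y < k
            pair = subst (λ m → codeg a y + m < k) y′≡y
              (codeg-pair-bound (proj₁ c-y) a∼y′ (∼-≁⇒≢ u∼y′ u≁y ∘ sym , y≁y′))

        Partner : Fin n → Fin n → Fin n → Set
        Partner u z y = z ∼ y × codeg a u + codeg a y ≡ ℓ

        classify-second : ∀ {u z y} → Free a b d u → u ∼ yP → u ∼ yQ → Nonadjacent a z →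
          Common a z u → Common a z y → y ≢ u → Partner u z yP ⊎ Partner u z yQ
        classify-second {u} {z} {y} f u∼yP u∼yQ az c-u c-y@(a∼y , z∼y) y≢u = go (∼-or-≁ b y) (∼-or-≁ d y)
          where
          open Free f
          u∼y : u ∼ y
          u∼y = second-adjacent f u∼yP az c-u c-y y≢u
          ℓ≡ : codeg a u + codeg a y ≡ ℓ
          ℓ≡ = ℓ-split az c-u c-y (y≢u ∘ sym)
          not-a : ∀ {w} → y ≡ a ⊎ y ≡ w → y ≡ w
          not-a (inj₁ y≡a) = ⊥-elim (∼⇒≢ a∼y (sym y≡a))
          not-a (inj₂ y≡w) = y≡w
          go : b ∼ y ⊎ b ≁ y → d ∼ y ⊎ d ≁ y → Partner u z yP ⊎ Partner u z yQ
          go (inj₁ b∼y) _ = inj₁ (subst (Partner u z) (not-a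
            (common-cases ub (∼-sym a∼u , ∼-sym a∼b) (u∼yP , proj₂ ab-yP) (∼⇒≢ a∼yP) (u∼y , b∼y)))
            (z∼y , ℓ≡))
          go (inj₂ _) (inj₁ d∼y) = inj₂ (subst (Partner u z) (not-a
            (common-cases ud (∼-sym a∼u , ∼-sym a∼d) (u∼yQ , proj₂ ad-yQ) (∼⇒≢ a∼yQ) (u∼y , d∼y)))
            (z∼y , ℓ≡))
          go (inj₂ b≁y) (inj₂ d≁y) = ⊥-elim (<-asym
            (small-part-is-smaller ℓ≡ (free-small f))
            (small-part-is-smaller (trans (+-comm (codeg a y) (codeg a u)) ℓ≡) (free-small fy)))
            where
            fy : Free a b d y
            fy = record { a∼u = a∼y ; b≁u = b≁y ; d≁u = d≁y
                        ; u≢b = ∼-≁⇒≢ u∼y (proj₂ ub) ; u≢d = ∼-≁⇒≢ u∼y (proj₂ ud) }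

        classify : ∀ {u z} → Free a b d u → u ∼ yP → u ∼ yQ → z ∈ N u ∖N[ a ] →
          Partner u z yP ⊎ Partner u z yQ
        classify {u} {z} f u∼yP u∼yQ z∈ with ∈N∖N[]⁻ z∈
        ... | u∼z , a≁z , z≢a with second-common (z≢a ∘ sym , a≁z) (Free.a∼u f , ∼-sym u∼z)
        ... | y , c-y , y≢u =
          classify-second f u∼yP u∼yQ (z≢a ∘ sym , a≁z) (Free.a∼u f , ∼-sym u∼z) c-y y≢u

        partner-codeg : ∀ {u y₁ y₂} → Free a b d u → Common a u y₁ → Common a u y₂ → y₁ ≢ y₂ →
          (∀ {z} → z ∈ N u ∖N[ a ] → Partner u z y₁ ⊎ Partner u z y₂) →
          codeg a u + codeg a y₁ ≡ ℓ
        partner-codeg {u} {y₁} {y₂} f c₁ c₂ y₁≢y₂ partner = go (∃-or-∅ (N u ∖N[ a ] ∩ N y₁))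
          where
          open Free f
          go : (∃[ z ] z ∈ N u ∖N[ a ] ∩ N y₁) ⊎ (∀ z → z ∉ N u ∖N[ a ] ∩ N y₁) →
            codeg a u + codeg a y₁ ≡ ℓ
          go (inj₁ (z , z∈)) with ∩⁻ (N u ∖N[ a ]) (N y₁) z∈
          ... | z∈ext , y₁∼z with partner z∈ext | ∈N∖N[]⁻ z∈ext
          ...   | inj₁ (_ , ℓ≡)   | _ = ℓ≡
          ...   | inj₂ (z∼y₂ , _) | u∼z , a≁z , z≢a = ⊥-elim (no-third-common (z≢a ∘ sym , a≁z)
                    (a∼u , ∼-sym u∼z) (proj₁ c₁ , ∼-sym y₁∼z) (proj₁ c₂ , z∼y₂)
                    (∼⇒≢ (proj₂ c₁)) (∼⇒≢ (proj₂ c₂)) y₁≢y₂)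
          go (inj₂ ∅) = ⊥-elim (<⇒≱ (small-part-is-smaller ℓ≡₂ (free-small f))
                                    (exterior-≤⇒codeg-≥ a∼u (proj₁ c₂) (∣∣-mono ext⊆)))
            where
            only-y₂ : ∀ {z} → z ∈ N u ∖N[ a ] → Partner u z y₂
            only-y₂ {z} z∈ with partner z∈
            ... | inj₁ (z∼y₁ , _) = ⊥-elim (true≢false (∧-true⁺ z∈ (∼-sym z∼y₁)) (∅ z))
            ... | inj₂ p          = p
            ℓ≡₂ : codeg a u + codeg a y₂ ≡ ℓ
            ℓ≡₂ = proj₂ (only-y₂ (proj₂ (exterior-nonempty f)))
            ext⊆ : N u ∖N[ a ] ⊆ N y₂ ∖N[ a ]
            ext⊆ z∈ with ∈N∖N[]⁻ z∈
            ... | _ , a≁z , z≢a = ∈N∖N[]⁺ (∼-sym (proj₁ (only-y₂ z∈))) a≁z z≢a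

        codeg-yP : ∀ {u} → Free a b d u → u ∼ yP → u ∼ yQ → codeg a u + codeg a yP ≡ ℓ
        codeg-yP f u∼yP u∼yQ =
          partner-codeg f (a∼yP , u∼yP) (a∼yQ , u∼yQ) yP≢yQ (classify f u∼yP u∼yQ)

        codeg-yQ : ∀ {u} → Free a b d u → u ∼ yP → u ∼ yQ → codeg a u + codeg a yQ ≡ ℓ
        codeg-yQ f u∼yP u∼yQ =
          partner-codeg f (a∼yQ , u∼yQ) (a∼yP , u∼yP) (yP≢yQ ∘ sym)
            (λ z∈ → swap (classify f u∼yP u∼yQ z∈))

        unshared-codeg-bound : ∀ {u} → Free a b d u → u ∼ yP → u ∼ yQ →
          (∀ x → x ∉ N a ∩ N u ∩ N yP ∩ N yQ) → codeg u yP + codeg u yQ ≤ suc k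
        unshared-codeg-bound {u} f u∼yP u∼yQ ∅ = begin
          codeg u yP + codeg u yQ
            ≤⟨ ∑∣∣-mono (N u ∩ N yP ∷ N u ∩ N yQ ∷ []) (N u ∷ ⁅ a ⁆ ∷ []) pointwise ⟩
          ∣ N u ∣ + ∣ ⁅ a ⁆ ∣       ≡⟨ cong₂ _+_ (regular u) (∣⁅⁆∣ a) ⟩
          k + 1                     ≡⟨ +-comm k 1 ⟩
          suc k                     ∎
          where
          open ≤-Reasoning
          tally : ∀ U P Q E → (U ≡ true → P ≡ true → Q ≡ true → E ≡ true) →
            # (U ∧ P ∷ U ∧ Q ∷ []) ≤ # (U ∷ E ∷ [])
          tally false _     _     _ _      = z≤n
          tally true  true  true  _ only-a rewrite only-a refl refl refl = ≤-refl
          tally true  true  false _ _      = s≤s z≤n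
          tally true  false true  _ _      = s≤s z≤n
          tally true  false false _ _      = z≤n
          pointwise : ∀ v → # (N u ∩ N yP ∷ N u ∩ N yQ ∷ []) ⟨ v ⟩ ≤ # (N u ∷ ⁅ a ⁆ ∷ []) ⟨ v ⟩
          pointwise v = tally (adj u v) (adj yP v) (adj yQ v) (⁅ a ⁆ v)
            (λ u∼v yP∼v yQ∼v → dec-true (v ≟ a) (only-a u∼v yP∼v yQ∼v))
            where
            only-a : u ∼ v → yP ∼ v → yQ ∼ v → v ≡ a
            only-a u∼v yP∼v yQ∼v with v ≟ a | ∼-or-≁ a v
            ... | yes v≡a | _        = v≡a
            ... | no  _   | inj₁ a∼v =
              ⊥-elim (true≢false (∧-true⁺ (∧-true⁺ (∧-true⁺ a∼v u∼v) yP∼v) yQ∼v) (∅ v))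
            ... | no  v≢a | inj₂ a≁v = ⊥-elim (no-third-common (v≢a ∘ sym , a≁v)
              (Free.a∼u f , ∼-sym u∼v) (a∼yP , ∼-sym yP∼v) (a∼yQ , ∼-sym yQ∼v)
              (∼⇒≢ u∼yP) (∼⇒≢ u∼yQ) yP≢yQ)

        no-shared-neighbour : ∀ {u} → Free a b d u → u ∼ yP → u ∼ yQ →
          (∀ x → x ∉ N a ∩ N u ∩ N yP ∩ N yQ) → ⊥
        no-shared-neighbour {u} f u∼yP u∼yQ ∅ = <⇒≱
          (degree<twice-large-part ℓ≡ (free-small f) 3k≤4ℓ)
          (subst (λ m → codeg u yP + m ≤ suc k) yQ≡yP (unshared-codeg-bound f u∼yP u∼yQ ∅))
          where
          open Free f
          ℓ≡ᴾ : codeg u a + codeg u yP ≡ ℓ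
          ℓ≡ᴾ = ℓ-split ub (∼-sym a∼u , ∼-sym a∼b) (u∼yP , proj₂ ab-yP) (∼⇒≢ a∼yP)
          yQ≡yP : codeg u yQ ≡ codeg u yP
          yQ≡yP = +-cancelˡ-≡ (codeg u a) _ _
            (trans (ℓ-split ud (∼-sym a∼u , ∼-sym a∼d) (u∼yQ , proj₂ ad-yQ) (∼⇒≢ a∼yQ)) (sym ℓ≡ᴾ))
          ℓ≡ : codeg a u + codeg u yP ≡ ℓ
          ℓ≡ = trans (cong (_+ codeg u yP) (codeg-comm a u)) ℓ≡ᴾ

        exterior-toward : ∀ {w z} → Free a b d w → w ∼ yP → w ∼ yQ → z ∈ N w ∖N[ a ] →
          z ∈ N yP ∖N[ a ] ⊎ z ∈ N yQ ∖N[ a ]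
        exterior-toward f w∼yP w∼yQ z∈ with ∈N∖N[]⁻ z∈ | classify f w∼yP w∼yQ z∈
        ... | _ , a≁z , z≢a | inj₁ (z∼yP , _) = inj₁ (∈N∖N[]⁺ (∼-sym z∼yP) a≁z z≢a)
        ... | _ , a≁z , z≢a | inj₂ (z∼yQ , _) = inj₂ (∈N∖N[]⁺ (∼-sym z∼yQ) a≁z z≢a)

        shared⇒free : ∀ {u x} → Free a b d u → u ∼ yP → u ∼ yQ →
          a ∼ x → u ∼ x → yP ∼ x → yQ ∼ x → Free a b d x
        shared⇒free f u∼yP u∼yQ a∼x u∼x yP∼x yQ∼x = record
          { a∼u = a∼x
          ; b≁u = ¬∼⇒≁ (λ b∼x → no-third-common ub (∼-sym a∼u , ∼-sym a∼b) (u∼yP , proj₂ ab-yP)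
                    (u∼x , b∼x) (∼⇒≢ a∼yP) (∼⇒≢ a∼x) (∼⇒≢ yP∼x))
          ; d≁u = ¬∼⇒≁ (λ d∼x → no-third-common ud (∼-sym a∼u , ∼-sym a∼d) (u∼yQ , proj₂ ad-yQ)
                    (u∼x , d∼x) (∼⇒≢ a∼yQ) (∼⇒≢ a∼x) (∼⇒≢ yQ∼x))
          ; u≢b = ∼-≁⇒≢ u∼x (proj₂ ub)
          ; u≢d = ∼-≁⇒≢ u∼x (proj₂ ud)
          }
          where open Free f

        exteriors-disjoint : ∀ {u x z} → Free a b d u → u ∼ yP → u ∼ yQ →
          a ∼ x → u ∼ x → yP ∼ x → yQ ∼ x → z ∈ N u ∖N[ a ] → z ∈ N x ∖N[ a ] → ⊥
        exteriors-disjoint f u∼yP u∼yQ a∼x u∼x yP∼x yQ∼x z∈u z∈x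
          with ∈N∖N[]⁻ z∈u | ∈N∖N[]⁻ z∈x | classify f u∼yP u∼yQ z∈u
        ... | u∼z , a≁z , z≢a | x∼z , _ | inj₁ (z∼yP , _) = no-third-common (z≢a ∘ sym , a≁z)
              (Free.a∼u f , ∼-sym u∼z) (a∼x , ∼-sym x∼z) (a∼yP , z∼yP)
              (∼⇒≢ u∼x) (∼⇒≢ u∼yP) (∼⇒≢ (∼-sym yP∼x))
        ... | u∼z , a≁z , z≢a | x∼z , _ | inj₂ (z∼yQ , _) = no-third-common (z≢a ∘ sym , a≁z)
              (Free.a∼u f , ∼-sym u∼z) (a∼x , ∼-sym x∼z) (a∼yQ , z∼yQ)
              (∼⇒≢ u∼x) (∼⇒≢ u∼yQ) (∼⇒≢ (∼-sym yQ∼x))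

        shared-neighbour : ∀ {u x} → Free a b d u → u ∼ yP → u ∼ yQ →
          x ∈ N a ∩ N u ∩ N yP ∩ N yQ → ⊥
        shared-neighbour {u} {x} f u∼yP u∼yQ x∈ with ∩⁻ (N a ∩ N u ∩ N yP) (N yQ) x∈
        ... | x∈₃ , yQ∼x with ∈N∩N∩N⁻ x∈₃
        ... | a∼x , u∼x , yP∼x = <⇒≱
          (small-parts<twice-large-part (codeg-yP f u∼yP u∼yQ) (free-small f) (free-small fx))
          (begin
            codeg a yP + codeg a yP   ≡⟨ cong (codeg a yP +_) yQ≡yP ⟨
            codeg a yP + codeg a yQ   ≤⟨ exteriors-≤⇒codegs-≥ (Free.a∼u f) a∼x a∼yP a∼yQ
                                           (∑∣∣-mono (N u ∖N[ a ] ∷ N x ∖N[ a ] ∷ [])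
                                                     (N yP ∖N[ a ] ∷ N yQ ∖N[ a ] ∷ []) pointwise) ⟩
            codeg a u + codeg a x     ∎)
          where
          open ≤-Reasoning
          fx : Free a b d x
          fx = shared⇒free f u∼yP u∼yQ a∼x u∼x yP∼x yQ∼x
          yQ≡yP : codeg a yQ ≡ codeg a yP
          yQ≡yP = +-cancelˡ-≡ (codeg a u) _ _ (trans (codeg-yQ f u∼yP u∼yQ) (sym (codeg-yP f u∼yP u∼yQ)))
          tally : ∀ O O′ P Q → (O ≡ true → O′ ≡ true → ⊥) →
            (O ≡ true → P ≡ true ⊎ Q ≡ true) → (O′ ≡ true → P ≡ true ⊎ Q ≡ true) →
            # (O ∷ O′ ∷ []) ≤ # (P ∷ Q ∷ [])
          tally true  true  _ _ disjoint _ _ = ⊥-elim (disjoint refl refl)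
          tally true  false _ _ _ cover _ with cover refl
          ... | inj₁ refl = s≤s z≤n
          ... | inj₂ refl = m≤n+m 1 _
          tally false true  _ _ _ _ cover with cover refl
          ... | inj₁ refl = s≤s z≤n
          ... | inj₂ refl = m≤n+m 1 _
          tally false false _ _ _ _ _ = z≤n
          pointwise : ∀ z → # (N u ∖N[ a ] ∷ N x ∖N[ a ] ∷ []) ⟨ z ⟩
                          ≤ # (N yP ∖N[ a ] ∷ N yQ ∖N[ a ] ∷ []) ⟨ z ⟩
          pointwise z = tally _ _ _ _ (exteriors-disjoint f u∼yP u∼yQ a∼x u∼x yP∼x yQ∼x)
            (exterior-toward f u∼yP u∼yQ) (exterior-toward fx (∼-sym yP∼x) (∼-sym yQ∼x))

        meeting-impossible : ∀ {u} → Free a b d u → u ∼ yP → u ∼ yQ → ⊥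
        meeting-impossible {u} f u∼yP u∼yQ with ∃-or-∅ (N a ∩ N u ∩ N yP ∩ N yQ)
        ... | inj₁ (_ , x∈) = shared-neighbour f u∼yP u∼yQ x∈
        ... | inj₂ ∅        = no-shared-neighbour f u∼yP u∼yQ ∅

    no-induced-quadrangle : 3 * k ≤ 4 * ℓ → ℓ + 3 ≤ k → ∀ {a b c d} →
      a ∼ b → b ∼ c → c ∼ d → d ∼ a → Nonadjacent a c → Nonadjacent b d → ⊥
    no-induced-quadrangle 3k≤4ℓ ℓ+3≤k a∼b b∼c c∼d d∼a ac bd =
      let u  , f             = Q.free-exists
          yP , ab-yP , u∼yP = Q.meets-b f
          yQ , ad-yQ , u∼yQ = Q′.meets-b (Free-swap f)
      in Q.Meeting.meeting-impossible ab-yP ad-yQ f u∼yP u∼yQ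
      where
      module Q  = Quadrangle 3k≤4ℓ ℓ+3≤k a∼b b∼c c∼d d∼a ac bd
      -- Q′ reads the same quadrangle as a d c b.
      module Q′ = Quadrangle 3k≤4ℓ ℓ+3≤k (∼-sym d∼a) (∼-sym c∼d) (∼-sym b∼c) (∼-sym a∼b)
                    ac (Nonadjacent-sym bd)

theorem4p2 : (n k ℓ : ℕ) → (G : Graph n) →
    ¬ (IsStronglyCoEdgeRegular G k 2 ℓ × HasInducedQuadrangle G ×
       3 * k ≤ 4 * ℓ × ℓ + 3 ≤ k)
theorem4p2 n k ℓ G (((regular , _ , _ , common≡2) , ellSum≡ℓ) ,
                    (a , b , c , d , _ , a≢c , _ , _ , b≢d , _ , a∼b , b∼c , c∼d , d∼a , a≁c , b≁d) ,
                    3k≤4ℓ , ℓ+3≤k) =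
  no-induced-quadrangle 3k≤4ℓ ℓ+3≤k a∼b b∼c c∼d d∼a (a≢c , ¬∼⇒≁ G a≁c) (b≢d , ¬∼⇒≁ G b≁d)
  where
  open Subsets n
  open StronglyCoEdgeRegular₂ G
    (λ x → trans (sym (countFin≡sumFin n (Graph.adj G x))) (regular x))
    (λ {x} {z} (x≢z , x≁z) →
       trans (sym (common≡codeg G x z)) (common≡2 x z x≢z (λ x∼z → true≢false x∼z x≁z)))
    (λ {x} {z} (x≢z , x≁z) → ellSum≡ℓ x z x≢z (λ x∼z → true≢false x∼z x≁z))
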